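{- Let $\mathsf{M}$ be a matroid of rank $k$ having a stressed hyperplane $H$ of cardinality $h$, and let $\widetilde{\mathsf{M}}$ be the relaxation of $\mathsf{M}$ at $H$. Then \[ T_{\widetilde{\mathsf{M}}}(x,y)=T_{\mathsf{M}}(x,y)+(x+y-xy)\sum_{j=k}^{h}\binom{h}{j}(y-1)^{j-k}.\]
   Context: The Tutte polynomial of a matroid $\mathsf{M}$ on $E$ with rank function $\operatorname{rk}$ is $T_{\mathsf{M}}(x,y)=\sum_{A\subseteq E}(x-1)^{\operatorname{rk}(E)-\operatorname{rk}(A)}(y-1)^{|A|-\operatorname{rk}(A)}$. A hyperplane of a rank-$k$ matroid is a flat of rank $k-1$; it is stressed if all its subsets of cardinality $k$ are circuits. If $\mathsf{M}=(E,\mathscr{B})$ has a stressed hyperplane $H$, the relaxation of $\mathsf{M}$ at $H$ is the matroid $(E,\mathscr{B}\sqcup\{S\subseteq H:|S|=k\})$. -}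

module Defs where

open import Data.Bool using (Bool; true; false; _∨_; _∧_)
open import Data.Nat as ℕ using (ℕ; zero; suc; _⊔_; _∸_)
open import Data.Nat.Combinatorics using (_C_)
open import Data.Integer as ℤ using (ℤ; +_)
open import Data.List using (List; []; _∷_; map; foldr; _++_; upTo)
open import Data.Vec using (_∷_; [])
open import Data.Fin using (Fin)
open import Data.Fin.Subset using (Subset; _⊆_; _∈_; _∉_; _∩_; _∪_; ∣_∣; ⁅_⁆; ⊤; _─_; inside; outside)
open import Data.Fin.Subset.Properties using (_⊆?_)
open import Data.Product using (Σ; ∃; _×_; _,_)
open import Relation.Nullary using (¬_; ⌊_⌋)
open import Relation.Binary.PropositionalEquality using (_≡_; _≢_)

allSubsets : (n : ℕ) → List (Subset n)
allSubsets zero = [] ∷ []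
allSubsets (suc n) = map (outside ∷_) (allSubsets n) ++ map (inside ∷_) (allSubsets n)

BasisPred : ℕ → Set
BasisPred n = Subset n → Bool

record IsMatroid {n : ℕ} (basis? : BasisPred n) : Set where
  field
    nonempty : ∃ λ B → basis? B ≡ true
    exchange : ∀ B₁ B₂ → basis? B₁ ≡ true → basis? B₂ ≡ true →
               ∀ x → x ∈ B₁ → x ∉ B₂ →
               ∃ λ y → y ∈ B₂ × y ∉ B₁ × basis? ((B₁ ─ ⁅ x ⁆) ∪ ⁅ y ⁆) ≡ true

rk : ∀ {n} → BasisPred n → Subset n → ℕ
rk {n} basis? A = foldr step 0 (allSubsets n)
  where
  step : Subset n → ℕ → ℕ
  step B m with basis? B
  ... | true  = ∣ A ∩ B ∣ ⊔ m
  ... | false = m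

Independent : ∀ {n} → BasisPred n → Subset n → Set
Independent basis? A = ∃ λ B → basis? B ≡ true × A ⊆ B

Dependent : ∀ {n} → BasisPred n → Subset n → Set
Dependent basis? A = ¬ Independent basis? A

Circuit : ∀ {n} → BasisPred n → Subset n → Set
Circuit basis? C = Dependent basis? C × (∀ S → S ⊆ C → S ≢ C → Independent basis? S)

Flat : ∀ {n} → BasisPred n → Subset n → Set
Flat basis? F = ∀ e → e ∉ F → rk basis? F ℕ.< rk basis? (F ∪ ⁅ e ⁆)

Hyperplane : ∀ {n} → BasisPred n → ℕ → Subset n → Set
Hyperplane basis? k H = Flat basis? H × rk basis? H ≡ k ∸ 1

StressedHyperplane : ∀ {n} → BasisPred n → ℕ → Subset n → Set
StressedHyperplane basis? k H =
  Hyperplane basis? k H × (∀ S → S ⊆ H → ∣ S ∣ ≡ k → Circuit basis? S)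

relax : ∀ {n} → BasisPred n → ℕ → Subset n → BasisPred n
relax basis? k H S = basis? S ∨ (⌊ S ⊆? H ⌋ ∧ ⌊ ∣ S ∣ ℕ.≟ k ⌋)

sumℤ : List ℤ → ℤ
sumℤ = foldr ℤ._+_ (+ 0)

tutte : ∀ {n} → BasisPred n → ℤ → ℤ → ℤ
tutte {n} basis? x y = sumℤ (map term (allSubsets n))
  where
  r = rk basis?
  term : Subset n → ℤ
  term A = ((x ℤ.- + 1) ℤ.^ (r ⊤ ∸ r A)) ℤ.* ((y ℤ.- + 1) ℤ.^ (∣ A ∣ ∸ r A))

-- Σ_{j=k}^{h} f(j)  (empty if h < k)
sumRange : ℕ → ℕ → (ℕ → ℤ) → ℤ
sumRange k h f = sumℤ (map (λ i → f (k ℕ.+ i)) (upTo (suc h ∸ k)))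

-- Relaxing H changes the rank of a set A only when A ⊆ H and |A| ≥ k.  Such an A
-- contains a k-subset of H, which is a circuit of M and a basis of the relaxation,
-- so its rank goes from k - 1 to k.  Every other rank, that of E included, is
-- unchanged: for a new basis B, either A ∩ B is a proper subset of the circuit B,
-- hence independent in M, or B ⊆ A and A ⊈ H; then a (k - 1)-subset of B together
-- with a point of A outside the hyperplane H is independent, so A has rank k in M.
-- Each such A therefore adds (y-1)^(|A|-k) - (x-1)(y-1)^(|A|-k+1)
-- = (x+y-xy)(y-1)^(|A|-k) to the Tutte polynomial, and there are C(h, j) of them
-- of size j.

module Submission where

open import Defs
open import Data.Nat using (ℕ; _∸_)
open import Data.Nat.Combinatorics using (_C_)
open import Data.Integer using (ℤ; +_; _+_; _-_; _*_; _^_)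
open import Data.Fin.Subset using (Subset; ∣_∣; ⊤)
open import Relation.Binary.PropositionalEquality using (_≡_)

open import Data.Nat as ℕ using (zero; suc; _≤_; _<_; z≤n; s≤s; _⊔_; _≤?_)
import Data.Nat.Properties as ℕ
open import Data.Nat.Combinatorics using (k>n⇒nCk≡0; nCk+nC[k+1]≡[n+1]C[k+1])
import Data.Integer.Properties as ℤ
open import Algebra.Properties.CommutativeSemigroup ℤ.+-commutativeSemigroup
  using () renaming (interchange to +-interchange)
open import Data.Bool using (true; false; if_then_else_)
open import Data.Fin using (Fin; zero; suc; _≟_)
open import Data.Vec using (_∷_; []; here; there)
open import Data.Fin.Subset
  using (_∈_; _∉_; _⊆_; _⊂_; _∩_; _∪_; _─_; ⁅_⁆; ⊥; inside; outside)
open import Data.Fin.Subset.Properties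
open import Data.List using (List; []; _∷_; _++_; foldr; map; applyUpTo)
open import Data.List.Properties using (map-++; map-∘; map-cong)
import Data.List.Membership.Propositional as List
open import Data.List.Membership.Propositional.Properties using (∈-++⁺ˡ; ∈-++⁺ʳ; ∈-map⁺)
import Data.List.Relation.Unary.Any as Any
open import Data.Product using (∃; _×_; _,_; proj₁; proj₂)
open import Data.Sum using (_⊎_; inj₁; inj₂)
open import Data.Empty using (⊥-elim)
open import Function using (_∘_)
open import Relation.Nullary using (¬_; yes; no; does; contradiction)
open import Relation.Nullary.Decidable using (dec-true; dec-false)
open import Data.Integer.Tactic.RingSolver using (solve-∀)
open import Relation.Binary.PropositionalEquality
  using (_≢_; refl; sym; trans; cong; cong₂; subst; subst₂; module ≡-Reasoning)

private
  variable
    n : ℕ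
    p q : Subset n
    x : Fin n

-- Finite sets

⊆⊎∃∉ : (p q : Subset n) → p ⊆ q ⊎ ∃ λ x → x ∈ p × x ∉ q
⊆⊎∃∉ [] [] = inj₁ λ ()
⊆⊎∃∉ (s ∷ p) (t ∷ q) with ⊆⊎∃∉ p q
... | inj₂ (x , x∈p , x∉q) = inj₂ (suc x , there x∈p , x∉q ∘ drop-there)
⊆⊎∃∉ (outside ∷ p) (t       ∷ q) | inj₁ p⊆q = inj₁ (out⊆ p⊆q)
⊆⊎∃∉ (inside  ∷ p) (inside  ∷ q) | inj₁ p⊆q = inj₁ (s⊆s p⊆q)
⊆⊎∃∉ (inside  ∷ p) (outside ∷ q) | inj₁ _   = inj₂ (zero , here , λ ())

x∉p⇒∣p∪⁅x⁆∣≡1+∣p∣ : x ∉ p → ∣ p ∪ ⁅ x ⁆ ∣ ≡ suc ∣ p ∣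
x∉p⇒∣p∪⁅x⁆∣≡1+∣p∣ {x = zero}  {outside ∷ p} _   = cong (suc ∘ ∣_∣) (∪-identityʳ p)
x∉p⇒∣p∪⁅x⁆∣≡1+∣p∣ {x = zero}  {inside  ∷ p} x∉p = contradiction here x∉p
x∉p⇒∣p∪⁅x⁆∣≡1+∣p∣ {x = suc x} {outside ∷ p} x∉p = x∉p⇒∣p∪⁅x⁆∣≡1+∣p∣ (x∉p ∘ there)
x∉p⇒∣p∪⁅x⁆∣≡1+∣p∣ {x = suc x} {inside  ∷ p} x∉p = cong suc (x∉p⇒∣p∪⁅x⁆∣≡1+∣p∣ (x∉p ∘ there))

x∈p⇒∣p∣≡1+∣p─⁅x⁆∣ : x ∈ p → ∣ p ∣ ≡ suc ∣ p ─ ⁅ x ⁆ ∣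
x∈p⇒∣p∣≡1+∣p─⁅x⁆∣ {x = zero}  {inside  ∷ p} here        = cong (suc ∘ ∣_∣) (sym (p─⊥≡p p))
x∈p⇒∣p∣≡1+∣p─⁅x⁆∣ {x = suc x} {outside ∷ p} (there x∈p) = x∈p⇒∣p∣≡1+∣p─⁅x⁆∣ x∈p
x∈p⇒∣p∣≡1+∣p─⁅x⁆∣ {x = suc x} {inside  ∷ p} (there x∈p) = cong suc (x∈p⇒∣p∣≡1+∣p─⁅x⁆∣ x∈p)

x∈p─q⇒x∉q : (p q : Subset n) → x ∈ p ─ q → x ∉ q
x∈p─q⇒x∉q (_ ∷ p) (outside ∷ q) here        ()
x∈p─q⇒x∉q (_ ∷ p) (_       ∷ q) (there x∈) (there x∈q) = x∈p─q⇒x∉q p q x∈ x∈q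

p∪⁅x⁆⊆q : p ⊆ q → x ∈ q → p ∪ ⁅ x ⁆ ⊆ q
p∪⁅x⁆⊆q {p = p} {x = x} p⊆q x∈q y∈ with x∈p∪q⁻ p ⁅ x ⁆ y∈
... | inj₁ y∈p = p⊆q y∈p
... | inj₂ y∈⁅x⁆ = subst (_∈ _) (sym (x∈⁅y⁆⇒x≡y x y∈⁅x⁆)) x∈q

⊆-∩ : p ⊆ q → ∀ {r} → p ⊆ r → p ⊆ q ∩ r
⊆-∩ p⊆q p⊆r x∈p = x∈p∩q⁺ (p⊆q x∈p , p⊆r x∈p)

∃-⊆-of-size : ∀ k (p : Subset n) → k ≤ ∣ p ∣ → ∃ λ q → q ⊆ p × ∣ q ∣ ≡ k
∃-⊆-of-size {n} zero p _ = ⊥ , ⊥⊆ , ∣⊥∣≡0 n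
∃-⊆-of-size (suc k) (outside ∷ p) k≤∣p∣ with ∃-⊆-of-size (suc k) p k≤∣p∣
... | q , q⊆p , ∣q∣≡k = outside ∷ q , out⊆ q⊆p , ∣q∣≡k
∃-⊆-of-size (suc k) (inside ∷ p) (s≤s k≤∣p∣) with ∃-⊆-of-size k p k≤∣p∣
... | q , q⊆p , ∣q∣≡k = inside ∷ q , s⊆s q⊆p , cong suc ∣q∣≡k

∈-allSubsets : (p : Subset n) → p List.∈ allSubsets n
∈-allSubsets [] = Any.here refl
∈-allSubsets {suc n} (outside ∷ p) = ∈-++⁺ˡ (∈-map⁺ (outside ∷_) (∈-allSubsets p))
∈-allSubsets {suc n} (inside ∷ p) =
  ∈-++⁺ʳ (map (outside ∷_) (allSubsets n)) (∈-map⁺ (inside ∷_) (∈-allSubsets p))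

p⊆q∪⁅x⁆⇒p─⁅x⁆⊆q : p ⊆ q ∪ ⁅ x ⁆ → p ─ ⁅ x ⁆ ⊆ q
p⊆q∪⁅x⁆⇒p─⁅x⁆⊆q {p = p} {q} {x} p⊆q∪x y∈ with x∈p∪q⁻ q ⁅ x ⁆ (p⊆q∪x (p─q⊆p p ⁅ x ⁆ y∈))
... | inj₁ y∈q   = y∈q
... | inj₂ y∈⁅x⁆ = contradiction y∈⁅x⁆ (x∈p─q⇒x∉q p ⁅ x ⁆ y∈)

x∉p∪⁅y⁆ : ∀ {y} → x ∉ p → x ≢ y → x ∉ p ∪ ⁅ y ⁆
x∉p∪⁅y⁆ {p = p} {y} x∉p x≢y x∈ with x∈p∪q⁻ p ⁅ y ⁆ x∈
... | inj₁ x∈p   = x∉p x∈p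
... | inj₂ x∈⁅y⁆ = x≢y (x∈⁅y⁆⇒x≡y y x∈⁅y⁆)

-- The rank function

-- rk folds a step function that is local to Defs; indexing by the unfolding
-- equation lets unification name that function in rk-step.
record IsMaxStep (b : BasisPred n) (A : Subset n) (step : Subset n → ℕ → ℕ)
                 (unfold : rk b A ≡ foldr step 0 (allSubsets n)) : Set where
  field
    step-basis    : ∀ B m → b B ≡ true  → step B m ≡ ∣ A ∩ B ∣ ⊔ m
    step-nonbasis : ∀ B m → b B ≡ false → step B m ≡ m

rk-step : (b : BasisPred n) (A : Subset n) → IsMaxStep b A _ refl
rk-step b A .IsMaxStep.step-basis B m _ with b B
... | true = refl
rk-step b A .IsMaxStep.step-nonbasis B m _ with b B
... | false = refl

module _ {b : BasisPred n} {A : Subset n} {step unfold} (isMax : IsMaxStep b A step unfold) where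
  open IsMaxStep isMax

  foldr-step-≥ : ∀ {B} l → B List.∈ l → b B ≡ true → ∣ A ∩ B ∣ ≤ foldr step 0 l
  foldr-step-≥ (B ∷ l) (Any.here refl) t rewrite step-basis B (foldr step 0 l) t = ℕ.m≤m⊔n _ _
  foldr-step-≥ (B′ ∷ l) (Any.there B∈l) t with b B′ in eq
  ... | true  rewrite step-basis B′ (foldr step 0 l) eq =
    ℕ.≤-trans (foldr-step-≥ l B∈l t) (ℕ.m≤n⊔m _ _)
  ... | false rewrite step-nonbasis B′ (foldr step 0 l) eq = foldr-step-≥ l B∈l t

  foldr-step-≤ : ∀ {m} l → (∀ B → b B ≡ true → ∣ A ∩ B ∣ ≤ m) → foldr step 0 l ≤ m
  foldr-step-≤ [] _ = z≤n
  foldr-step-≤ (B′ ∷ l) bound with b B′ in eq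
  ... | true  rewrite step-basis B′ (foldr step 0 l) eq = ℕ.⊔-lub (bound B′ eq) (foldr-step-≤ l bound)
  ... | false rewrite step-nonbasis B′ (foldr step 0 l) eq = foldr-step-≤ l bound

  foldr-step-attained : ∀ l → foldr step 0 l ≡ 0 ⊎ ∃ λ B → b B ≡ true × foldr step 0 l ≡ ∣ A ∩ B ∣
  foldr-step-attained [] = inj₁ refl
  foldr-step-attained (B′ ∷ l) with b B′ in eq | foldr-step-attained l
  ... | false | ih rewrite step-nonbasis B′ (foldr step 0 l) eq = ih
  ... | true | inj₁ ≡0 rewrite step-basis B′ (foldr step 0 l) eq | ≡0 = inj₂ (B′ , eq , ℕ.⊔-identityʳ _)
  ... | true | inj₂ (B , t , ≡∣A∩B∣) rewrite step-basis B′ (foldr step 0 l) eq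
    with ℕ.⊔-sel ∣ A ∩ B′ ∣ (foldr step 0 l)
  ...   | inj₁ ≡∣A∩B′∣ = inj₂ (B′ , eq , ≡∣A∩B′∣)
  ...   | inj₂ ≡rest  = inj₂ (B , t , trans ≡rest ≡∣A∩B∣)

module _ (b : BasisPred n) where

  rk-basis : ∀ A {B} → b B ≡ true → ∣ A ∩ B ∣ ≤ rk b A
  rk-basis A t = foldr-step-≥ (rk-step b A) (allSubsets _) (∈-allSubsets _) t

  rk-lub : ∀ A {m} → (∀ B → b B ≡ true → ∣ A ∩ B ∣ ≤ m) → rk b A ≤ m
  rk-lub A bound = foldr-step-≤ (rk-step b A) (allSubsets _) bound

  rk-mono : p ⊆ q → rk b p ≤ rk b q
  rk-mono {p = p} {q} p⊆q = rk-lub p λ B t →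
    ℕ.≤-trans (p⊆q⇒∣p∣≤∣q∣ (⊆-∩ (p⊆q ∘ proj₁ ∘ x∈p∩q⁻ p B) (proj₂ ∘ x∈p∩q⁻ p B))) (rk-basis q t)

  independent⇒∣∣≤rk : p ⊆ q → Independent b p → ∣ p ∣ ≤ rk b q
  independent⇒∣∣≤rk {q = q} p⊆q (B , t , p⊆B) = ℕ.≤-trans (p⊆q⇒∣p∣≤∣q∣ (⊆-∩ p⊆q p⊆B)) (rk-basis q t)

  rk-attained : IsMatroid b → ∀ A → ∃ λ B → b B ≡ true × rk b A ≡ ∣ A ∩ B ∣
  rk-attained M A with foldr-step-attained (rk-step b A) (allSubsets _)
  ... | inj₂ attained = attained
  ... | inj₁ rk≡0 with IsMatroid.nonempty M
  ...   | B , t = B , t , ℕ.≤-antisym (subst (_≤ _) (sym rk≡0) z≤n) (rk-basis A t)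

-- Hyperplanes

-- Taking the rank to be suc r makes the rank suc r ∸ 1 of a hyperplane reduce to r.
module HyperplaneOfRankSuc {b : BasisPred n} (M : IsMatroid b) {r : ℕ} (rk⊤ : rk b ⊤ ≡ suc r)
                           {H : Subset n} (hyp : Hyperplane b (suc r) H) where

  open IsMatroid M

  ∣basis∣≤1+r : ∀ {B} → b B ≡ true → ∣ B ∣ ≤ suc r
  ∣basis∣≤1+r {B} t = subst (∣ B ∣ ≤_) rk⊤
    (ℕ.≤-trans (p⊆q⇒∣p∣≤∣q∣ {p = B} (⊆-∩ (λ _ → ∈⊤) (λ x∈ → x∈))) (rk-basis b ⊤ t))

  ∣H∩basis∣≤r : ∀ {B} → b B ≡ true → ∣ H ∩ B ∣ ≤ r
  ∣H∩basis∣≤r {B} t = subst (∣ H ∩ B ∣ ≤_) (proj₂ hyp) (rk-basis b H t)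

  H∩basis⊆ : ∀ {S B} → S ⊆ H ∩ B → ∣ S ∣ ≡ r → b B ≡ true → H ∩ B ⊆ S
  H∩basis⊆ {S} S⊆H∩B ∣S∣≡r t {y} y∈H∩B with y ∈? S
  ... | yes y∈S = y∈S
  ... | no  y∉S = contradiction (ℕ.≤-trans 1+r≤ (∣H∩basis∣≤r t)) ℕ.1+n≰n
    where
    1+r≤ : suc r ≤ ∣ H ∩ _ ∣
    1+r≤ = subst (_≤ _) (trans (x∉p⇒∣p∪⁅x⁆∣≡1+∣p∣ y∉S) (cong suc ∣S∣≡r))
                 (p⊆q⇒∣p∣≤∣q∣ (p∪⁅x⁆⊆q S⊆H∩B y∈H∩B))

  basis-through : ∀ {e} → e ∉ H →
                  ∃ λ B → b B ≡ true × e ∈ B × B ⊆ H ∪ ⁅ e ⁆ × suc r ≤ ∣ B ∣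
  basis-through {e} e∉H with rk-attained b M (H ∪ ⁅ e ⁆)
  ... | B , t , rk≡ = B , t , e∈B , B⊆H+e , ℕ.≤-trans 1+r≤ (∣p∩q∣≤∣q∣ (H ∪ ⁅ e ⁆) B)
    where
    1+r≤ : suc r ≤ ∣ (H ∪ ⁅ e ⁆) ∩ B ∣
    1+r≤ = subst₂ _≤_ (cong suc (proj₂ hyp)) rk≡ (proj₁ hyp e e∉H)
    B⊆H+e : B ⊆ H ∪ ⁅ e ⁆
    B⊆H+e with ⊆⊎∃∉ B (H ∪ ⁅ e ⁆)
    ... | inj₁ ⊆H+e = ⊆H+e
    ... | inj₂ (y , y∈B , y∉H+e) = contradiction
      (ℕ.≤-<-trans 1+r≤ (ℕ.<-≤-trans (p⊂q⇒∣p∣<∣q∣ ∩⊂B) (∣basis∣≤1+r t))) (ℕ.<-irrefl refl)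
      where
      ∩⊂B : (H ∪ ⁅ e ⁆) ∩ B ⊂ B
      ∩⊂B = p∩q⊆q (H ∪ ⁅ e ⁆) B , y , y∈B , y∉H+e ∘ proj₁ ∘ x∈p∩q⁻ (H ∪ ⁅ e ⁆) B
    e∈B : e ∈ B
    e∈B with e ∈? B
    ... | yes e∈B = e∈B
    ... | no  e∉B = contradiction (ℕ.≤-trans 1+r≤ (ℕ.≤-trans (p⊆q⇒∣p∣≤∣q∣ ∩⊆H∩B) (∣H∩basis∣≤r t))) ℕ.1+n≰n
      where
      ∩⊆H∩B : (H ∪ ⁅ e ⁆) ∩ B ⊆ H ∩ B
      ∩⊆H∩B x∈ with x∈p∩q⁻ (H ∪ ⁅ e ⁆) B x∈
      ... | x∈H+e , x∈B with x∈p∪q⁻ H ⁅ e ⁆ x∈H+e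
      ...   | inj₁ x∈H   = x∈p∩q⁺ (x∈H , x∈B)
      ...   | inj₂ x∈⁅e⁆ = contradiction (subst (_∈ B) (x∈⁅y⁆⇒x≡y e x∈⁅e⁆) x∈B) e∉B

  -- If B ⊆ H, exchanging e out of the basis B₁ ⊆ H ∪ ⁅ e ⁆ for an element of B
  -- would give a basis of size suc r inside H.
  basis⊈hyperplane : ∀ {e B} → e ∉ H → b B ≡ true → ∃ λ z → z ∈ B × z ∉ H
  basis⊈hyperplane {e} {B} e∉H t with ⊆⊎∃∉ B H
  ... | inj₂ z∈B∖H = z∈B∖H
  ... | inj₁ B⊆H with basis-through e∉H
  ...   | B₁ , t₁ , e∈B₁ , B₁⊆H+e , 1+r≤∣B₁∣ with exchange B₁ B t₁ t e e∈B₁ (e∉H ∘ B⊆H)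
  ...     | y , y∈B , y∉B₁ , t₂ = contradiction (ℕ.≤-trans 1+r≤∣H∩B₂∣ (∣H∩basis∣≤r t₂)) ℕ.1+n≰n
    where
    B₂ = (B₁ ─ ⁅ e ⁆) ∪ ⁅ y ⁆
    ∣B₂∣≡∣B₁∣ : ∣ B₂ ∣ ≡ ∣ B₁ ∣
    ∣B₂∣≡∣B₁∣ = trans (x∉p⇒∣p∪⁅x⁆∣≡1+∣p∣ (y∉B₁ ∘ p─q⊆p B₁ ⁅ e ⁆)) (sym (x∈p⇒∣p∣≡1+∣p─⁅x⁆∣ e∈B₁))
    B₂⊆H : B₂ ⊆ H
    B₂⊆H = p∪⁅x⁆⊆q (p⊆q∪⁅x⁆⇒p─⁅x⁆⊆q B₁⊆H+e) (B⊆H y∈B)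
    1+r≤∣H∩B₂∣ : suc r ≤ ∣ H ∩ B₂ ∣
    1+r≤∣H∩B₂∣ = ℕ.≤-trans (subst (suc r ≤_) (sym ∣B₂∣≡∣B₁∣) 1+r≤∣B₁∣)
                           (p⊆q⇒∣p∣≤∣q∣ (⊆-∩ B₂⊆H (λ x∈ → x∈)))

  -- Exchange some z ∈ B ∖ H for an element y of a basis inside H ∪ ⁅ e ⁆;
  -- y cannot lie in H, since H ∩ B₂ ⊆ S ⊆ B.
  independent-extend : ∀ {S e} → S ⊆ H → ∣ S ∣ ≡ r → Independent b S → e ∉ H →
                       Independent b (S ∪ ⁅ e ⁆)
  independent-extend {S} {e} S⊆H ∣S∣≡r (B , t , S⊆B) e∉H
    with basis⊈hyperplane e∉H t | basis-through e∉H
  ... | z , z∈B , z∉H | B₁ , t₁ , _ , B₁⊆H+e , _ with z ≟ e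
  ...   | yes refl = B , t , p∪⁅x⁆⊆q S⊆B z∈B
  ...   | no  z≢e with exchange B B₁ t t₁ z z∈B (x∉p∪⁅y⁆ z∉H z≢e ∘ B₁⊆H+e)
  ...     | y , y∈B₁ , y∉B , t₂ = B₂ , t₂ , p∪⁅x⁆⊆q S⊆B₂ e∈B₂
    where
    B₂ = (B ─ ⁅ z ⁆) ∪ ⁅ y ⁆
    S⊆B₂ : S ⊆ B₂
    S⊆B₂ x∈S = x∈p∪q⁺ (inj₁ (x∈p∧x∉q⇒x∈p─q (S⊆B x∈S)
      (λ x∈⁅z⁆ → z∉H (subst (_∈ H) (x∈⁅y⁆⇒x≡y z x∈⁅z⁆) (S⊆H x∈S)))))
    y∈B₂ : y ∈ B₂
    y∈B₂ = x∈p∪q⁺ (inj₂ (x∈⁅x⁆ y))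
    e∈B₂ : e ∈ B₂
    e∈B₂ with x∈p∪q⁻ H ⁅ e ⁆ (B₁⊆H+e y∈B₁)
    ... | inj₂ y∈⁅e⁆ = subst (_∈ B₂) (x∈⁅y⁆⇒x≡y e y∈⁅e⁆) y∈B₂
    ... | inj₁ y∈H   =
      contradiction (S⊆B (H∩basis⊆ (⊆-∩ S⊆H S⊆B₂) ∣S∣≡r t₂ (x∈p∩q⁺ (y∈H , y∈B₂)))) y∉B

-- Relaxation

module _ (b : BasisPred n) (k : ℕ) (H : Subset n) where

  relax-⊇ : ∀ {B} → b B ≡ true → relax b k H B ≡ true
  relax-⊇ t rewrite t = refl

  relax-new : ∀ {B} → B ⊆ H → ∣ B ∣ ≡ k → relax b k H B ≡ true
  relax-new {B} B⊆H ∣B∣≡k with b B | B ⊆? H | ∣ B ∣ ℕ.≟ k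
  ... | true  | _         | _     = refl
  ... | false | yes _     | yes _ = refl
  ... | false | no B⊈H    | _     = ⊥-elim (B⊈H B⊆H)
  ... | false | yes _     | no ≢k = contradiction ∣B∣≡k ≢k

  relax-basis : ∀ {B} → relax b k H B ≡ true → b B ≡ true ⊎ (B ⊆ H × ∣ B ∣ ≡ k)
  relax-basis {B} t with b B | B ⊆? H | ∣ B ∣ ℕ.≟ k
  ... | true  | _         | _         = inj₁ refl
  ... | false | yes B⊆H   | yes ∣B∣≡k = inj₂ (B⊆H , ∣B∣≡k)
  ... | false | no _      | _         = contradiction t λ ()
  ... | false | yes _     | no _      = contradiction t λ ()

-- tutte b x y is definitionally the sum of tutteTerm b x y over allSubsets n.
tutteTerm : BasisPred n → ℤ → ℤ → Subset n → ℤ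
tutteTerm b x y A = ((x - + 1) ^ (rk b ⊤ ∸ rk b A)) * ((y - + 1) ^ (∣ A ∣ ∸ rk b A))

tutteTerm-by-ranks : (b : BasisPred n) (x y : ℤ) (A : Subset n) {t a : ℕ} →
  rk b ⊤ ≡ t → rk b A ≡ a → tutteTerm b x y A ≡ (x - + 1) ^ (t ∸ a) * (y - + 1) ^ (∣ A ∣ ∸ a)
tutteTerm-by-ranks b x y A refl refl = refl

powFrom : ℕ → ℤ → ℕ → ℤ
powFrom k z j = if does (k ≤? j) then z ^ (j ∸ k) else + 0

powFrom-≥ : ∀ {k j} z → k ≤ j → powFrom k z j ≡ z ^ (j ∸ k)
powFrom-≥ {k} {j} z k≤j rewrite dec-true (k ≤? j) k≤j = refl

powFrom-< : ∀ {k j} z → j < k → powFrom k z j ≡ + 0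
powFrom-< {k} {j} z j<k rewrite dec-false (k ≤? j) (ℕ.<⇒≱ j<k) = refl

weight⊆ : Subset n → (ℕ → ℤ) → Subset n → ℤ
weight⊆ H φ A = if does (A ⊆? H) then φ ∣ A ∣ else + 0

m∸n≡1+m∸[1+n] : ∀ {m n} → suc n ≤ m → m ∸ n ≡ suc (m ∸ suc n)
m∸n≡1+m∸[1+n] {suc m} {zero}  _         = refl
m∸n≡1+m∸[1+n] {suc m} {suc n} (s≤s n<m) = m∸n≡1+m∸[1+n] n<m

x≡x+y*0 : ∀ x y → x ≡ x + y * + 0
x≡x+y*0 x y = sym (trans (cong (_+_ x) (ℤ.*-zeroʳ y)) (ℤ.+-identityʳ x))

-- (x - 1)(y - 1) + (x + y - xy) = 1, in the shape of the relaxed term.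
relaxation-identity : ∀ x y u → + 1 * u ≡ ((x - + 1) * + 1) * ((y - + 1) * u) + (x + y - x * y) * u
relaxation-identity = solve-∀

module Relaxation {b : BasisPred n} (M : IsMatroid b) {r : ℕ} (rk⊤ : rk b ⊤ ≡ suc r)
                  {H : Subset n} (stressed : StressedHyperplane b (suc r) H) where

  open HyperplaneOfRankSuc M rk⊤ (proj₁ stressed)

  relaxed : BasisPred n
  relaxed = relax b (suc r) H

  ∃-independent-r-subset : ∀ {S} → S ⊆ H → ∣ S ∣ ≡ suc r →
                     ∃ λ S′ → S′ ⊆ S × ∣ S′ ∣ ≡ r × Independent b S′
  ∃-independent-r-subset {S} S⊆H ∣S∣≡1+r with ∃-⊆-of-size r S (subst (r ≤_) (sym ∣S∣≡1+r) (ℕ.n≤1+n r))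
  ... | S′ , S′⊆S , ∣S′∣≡r =
    S′ , S′⊆S , ∣S′∣≡r , proj₂ (proj₂ stressed S S⊆H ∣S∣≡1+r) S′ S′⊆S
      λ S′≡S → ℕ.1+n≢n (trans (sym ∣S∣≡1+r) (trans (cong ∣_∣ (sym S′≡S)) ∣S′∣≡r))

  1+r≤rk : ∀ {A S e} → S ⊆ A → S ⊆ H → ∣ S ∣ ≡ suc r → e ∈ A → e ∉ H → suc r ≤ rk b A
  1+r≤rk {A} S⊆A S⊆H ∣S∣≡1+r e∈A e∉H with ∃-independent-r-subset S⊆H ∣S∣≡1+r
  ... | S′ , S′⊆S , ∣S′∣≡r , S′-indep =
    subst (_≤ rk b A) (trans (x∉p⇒∣p∪⁅x⁆∣≡1+∣p∣ (λ e∈S′ → e∉H (S⊆H (S′⊆S e∈S′)))) (cong suc ∣S′∣≡r))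
      (independent⇒∣∣≤rk b (p∪⁅x⁆⊆q (λ x∈ → S⊆A (S′⊆S x∈)) e∈A)
        (independent-extend (λ x∈ → S⊆H (S′⊆S x∈)) ∣S′∣≡r S′-indep e∉H))

  rk-large-⊆H : ∀ {A} → A ⊆ H → suc r ≤ ∣ A ∣ → rk b A ≡ r
  rk-large-⊆H {A} A⊆H 1+r≤∣A∣ with ∃-⊆-of-size (suc r) A 1+r≤∣A∣
  ... | S , S⊆A , ∣S∣≡1+r with ∃-independent-r-subset (λ x∈ → A⊆H (S⊆A x∈)) ∣S∣≡1+r
  ...   | S′ , S′⊆S , ∣S′∣≡r , S′-indep = ℕ.≤-antisym
    (subst (rk b A ≤_) (proj₂ (proj₁ stressed)) (rk-mono b A⊆H))
    (subst (_≤ rk b A) ∣S′∣≡r (independent⇒∣∣≤rk b (λ x∈ → S⊆A (S′⊆S x∈)) S′-indep))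

  rk-relaxed-large-⊆H : ∀ {A} → A ⊆ H → suc r ≤ ∣ A ∣ → rk relaxed A ≡ suc r
  rk-relaxed-large-⊆H {A} A⊆H 1+r≤∣A∣ with ∃-⊆-of-size (suc r) A 1+r≤∣A∣
  ... | S , S⊆A , ∣S∣≡1+r = ℕ.≤-antisym
    (rk-lub relaxed A λ B t → ℕ.≤-trans (∣p∩q∣≤∣q∣ A B) (∣relaxed-basis∣ t))
    (subst (_≤ rk relaxed A) ∣S∣≡1+r
      (independent⇒∣∣≤rk relaxed S⊆A (S , relax-new b (suc r) H (λ x∈ → A⊆H (S⊆A x∈)) ∣S∣≡1+r , λ x∈ → x∈)))
    where
    ∣relaxed-basis∣ : ∀ {B} → relaxed B ≡ true → ∣ B ∣ ≤ suc r
    ∣relaxed-basis∣ t with relax-basis b (suc r) H t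
    ... | inj₁ t′            = ∣basis∣≤1+r t′
    ... | inj₂ (_ , ∣B∣≡1+r) = ℕ.≤-reflexive ∣B∣≡1+r

  rk-relaxed-other : ∀ {A} → ¬ (A ⊆ H × suc r ≤ ∣ A ∣) → rk relaxed A ≡ rk b A
  rk-relaxed-other {A} not-large = ℕ.≤-antisym (rk-lub relaxed A bound)
    (rk-lub b A λ B t → rk-basis relaxed A (relax-⊇ b (suc r) H t))
    where
    bound : ∀ B → relaxed B ≡ true → ∣ A ∩ B ∣ ≤ rk b A
    bound B t with relax-basis b (suc r) H t
    ... | inj₁ t′ = rk-basis b A t′
    ... | inj₂ (B⊆H , ∣B∣≡1+r) with ⊆⊎∃∉ B A
    ...   | inj₂ (x , x∈B , x∉A) = independent⇒∣∣≤rk b (p∩q⊆p A B)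
      (proj₂ (proj₂ stressed B B⊆H ∣B∣≡1+r) (A ∩ B) (p∩q⊆q A B)
        λ A∩B≡B → x∉A (proj₁ (x∈p∩q⁻ A B (subst (x ∈_) (sym A∩B≡B) x∈B))))
    ...   | inj₁ B⊆A with ⊆⊎∃∉ A H
    ...     | inj₁ A⊆H = ⊥-elim (not-large (A⊆H , subst (_≤ ∣ A ∣) ∣B∣≡1+r (p⊆q⇒∣p∣≤∣q∣ B⊆A)))
    ...     | inj₂ (e , e∈A , e∉H) = ℕ.≤-trans (∣p∩q∣≤∣q∣ A B)
      (subst (_≤ rk b A) (sym ∣B∣≡1+r) (1+r≤rk B⊆A B⊆H ∣B∣≡1+r e∈A e∉H))

  rk-relaxed-⊤ : rk relaxed ⊤ ≡ suc r
  rk-relaxed-⊤ = trans (rk-relaxed-other {A = ⊤} ⊤-not-large) rk⊤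
    where
    ⊤-not-large : ¬ (⊤ ⊆ H × suc r ≤ ∣ ⊤ {n} ∣)
    ⊤-not-large (⊤⊆H , _) = ℕ.1+n≰n (subst₂ _≤_ rk⊤ (proj₂ (proj₁ stressed)) (rk-mono b ⊤⊆H))

  tutteTerm-relaxed-other : ∀ x y {A} → ¬ (A ⊆ H × suc r ≤ ∣ A ∣) →
                            tutteTerm relaxed x y A ≡ tutteTerm b x y A
  tutteTerm-relaxed-other x y {A} not-large =
    tutteTerm-by-ranks relaxed x y A (trans rk-relaxed-⊤ (sym rk⊤)) (rk-relaxed-other not-large)

  tutteTerm-relaxed-large : ∀ x y {A} → A ⊆ H → suc r ≤ ∣ A ∣ →
    tutteTerm relaxed x y A ≡ tutteTerm b x y A + (x + y - x * y) * (y - + 1) ^ (∣ A ∣ ∸ suc r)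
  tutteTerm-relaxed-large x y {A} A⊆H large = begin
    tutteTerm relaxed x y A
      ≡⟨ tutteTerm-by-ranks relaxed x y A rk-relaxed-⊤ (rk-relaxed-large-⊆H A⊆H large) ⟩
    (x - + 1) ^ (r ∸ r) * u
      ≡⟨ cong (λ a → (x - + 1) ^ a * u) (ℕ.n∸n≡0 r) ⟩
    + 1 * u
      ≡⟨ relaxation-identity x y u ⟩
    (x - + 1) ^ 1 * (y - + 1) ^ suc (∣ A ∣ ∸ suc r) + c * u
      ≡⟨ cong₂ (λ a d → (x - + 1) ^ a * (y - + 1) ^ d + c * u)
               (sym (ℕ.m+n∸n≡m 1 r)) (sym (m∸n≡1+m∸[1+n] large)) ⟩
    (x - + 1) ^ (suc r ∸ r) * (y - + 1) ^ (∣ A ∣ ∸ r) + c * u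
      ≡⟨ cong (_+ c * u) (tutteTerm-by-ranks b x y A rk⊤ (rk-large-⊆H A⊆H large)) ⟨
    tutteTerm b x y A + c * u ∎
    where
    open ≡-Reasoning
    c = x + y - x * y
    u = (y - + 1) ^ (∣ A ∣ ∸ suc r)

  tutteTerm-relaxed : ∀ x y A →
    tutteTerm relaxed x y A
      ≡ tutteTerm b x y A
        + (x + y - x * y) * (weight⊆ H (powFrom (suc r) (y - + 1)) A)
  tutteTerm-relaxed x y A with A ⊆? H | suc r ≤? ∣ A ∣
  ... | yes A⊆H | yes large = trans (tutteTerm-relaxed-large x y A⊆H large)
    (cong (λ w → tutteTerm b x y A + (x + y - x * y) * w) (sym (powFrom-≥ (y - + 1) large)))
  ... | yes A⊆H | no small = trans (tutteTerm-relaxed-other x y λ (_ , large) → small large)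
    (trans (x≡x+y*0 (tutteTerm b x y A) (x + y - x * y))
           (cong (λ w → tutteTerm b x y A + (x + y - x * y) * w) (sym (powFrom-< (y - + 1) (ℕ.≰⇒> small)))))
  ... | no A⊈H | _ = trans (tutteTerm-relaxed-other x y λ (A⊆H , _) → A⊈H A⊆H)
                           (x≡x+y*0 (tutteTerm b x y A) (x + y - x * y))

-- Sums

∑< : ℕ → (ℕ → ℤ) → ℤ
∑< zero    f = + 0
∑< (suc m) f = f 0 + ∑< m (f ∘ suc)

∑<-cong : ∀ m {f g : ℕ → ℤ} → (∀ j → f j ≡ g j) → ∑< m f ≡ ∑< m g
∑<-cong zero    f≗g = refl
∑<-cong (suc m) f≗g = cong₂ _+_ (f≗g 0) (∑<-cong m (f≗g ∘ suc))

∑<-distrib-+ : ∀ m (f g : ℕ → ℤ) → ∑< m (λ j → f j + g j) ≡ ∑< m f + ∑< m g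
∑<-distrib-+ zero    f g = refl
∑<-distrib-+ (suc m) f g =
  trans (cong (_+_ (f 0 + g 0)) (∑<-distrib-+ m (f ∘ suc) (g ∘ suc)))
        (+-interchange (f 0) (g 0) (∑< m (f ∘ suc)) (∑< m (g ∘ suc)))

∑<-suc-last : ∀ m (f : ℕ → ℤ) → ∑< (suc m) f ≡ ∑< m f + f m
∑<-suc-last zero    f = trans (ℤ.+-identityʳ (f 0)) (sym (ℤ.+-identityˡ (f 0)))
∑<-suc-last (suc m) f =
  trans (cong (_+_ (f 0)) (∑<-suc-last m (f ∘ suc))) (sym (ℤ.+-assoc (f 0) _ _))

∑<-drop : ∀ k m (f : ℕ → ℤ) → (∀ j → j < k → f j ≡ + 0) →
          ∑< m f ≡ ∑< (m ∸ k) (λ i → f (k ℕ.+ i))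
∑<-drop zero    m       f _     = refl
∑<-drop (suc k) zero    f _     = refl
∑<-drop (suc k) (suc m) f zeros =
  trans (cong₂ _+_ (zeros 0 (s≤s z≤n)) (∑<-drop k m (f ∘ suc) (λ j → zeros (suc j) ∘ s≤s)))
        (ℤ.+-identityˡ _)

∑<-pascal : ∀ h (φ : ℕ → ℤ) →
  ∑< (suc h) (λ j → + (h C j) * φ j) + ∑< (suc h) (λ j → + (h C j) * φ (suc j))
    ≡ ∑< (suc (suc h)) (λ j → + (suc h C j) * φ j)
∑<-pascal h φ = begin
  ∑< (suc h) F + ∑< (suc h) G
    ≡⟨ cong (λ s → (F 0 + s) + ∑< (suc h) G) F-tail ⟩
  (F 0 + ∑< (suc h) (F ∘ suc)) + ∑< (suc h) G
    ≡⟨ ℤ.+-assoc (F 0) _ _ ⟩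
  F 0 + (∑< (suc h) (F ∘ suc) + ∑< (suc h) G)
    ≡⟨ cong (_+_ (F 0)) (∑<-distrib-+ (suc h) (F ∘ suc) G) ⟨
  F 0 + ∑< (suc h) (λ j → F (suc j) + G j)
    ≡⟨ cong (_+_ (F 0)) (∑<-cong (suc h) pascal) ⟩
  F 0 + ∑< (suc h) (λ j → + (suc h C suc j) * φ (suc j)) ∎
  where
  open ≡-Reasoning
  F G : ℕ → ℤ
  F j = + (h C j) * φ j
  G j = + (h C j) * φ (suc j)
  F-tail : ∑< h (F ∘ suc) ≡ ∑< (suc h) (F ∘ suc)
  F-tail = sym (begin
    ∑< (suc h) (F ∘ suc)    ≡⟨ ∑<-suc-last h (F ∘ suc) ⟩
    ∑< h (F ∘ suc) + F (suc h)
      ≡⟨ cong (λ c → ∑< h (F ∘ suc) + + c * φ (suc h)) (k>n⇒nCk≡0 (ℕ.n<1+n h)) ⟩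
    ∑< h (F ∘ suc) + + 0 * φ (suc h)   ≡⟨ ℤ.+-identityʳ _ ⟩
    ∑< h (F ∘ suc) ∎)
  pascal : ∀ j → F (suc j) + G j ≡ + (suc h C suc j) * φ (suc j)
  pascal j = begin
    + (h C suc j) * φ (suc j) + + (h C j) * φ (suc j)   ≡⟨ ℤ.*-distribʳ-+ (φ (suc j)) (+ (h C suc j)) (+ (h C j)) ⟨
    + (h C suc j ℕ.+ h C j) * φ (suc j)
      ≡⟨ cong (λ c → + c * φ (suc j)) (trans (ℕ.+-comm (h C suc j) _) (nCk+nC[k+1]≡[n+1]C[k+1] h j)) ⟩
    + (suc h C suc j) * φ (suc j) ∎

sumℤ-++ : (xs ys : List ℤ) → sumℤ (xs ++ ys) ≡ sumℤ xs + sumℤ ys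
sumℤ-++ []       ys = sym (ℤ.+-identityˡ _)
sumℤ-++ (x ∷ xs) ys = trans (cong (_+_ x) (sumℤ-++ xs ys)) (sym (ℤ.+-assoc x _ _))

module _ {A : Set} where

  sumℤ-map-+ : (f g : A → ℤ) (l : List A) →
               sumℤ (map (λ a → f a + g a) l) ≡ sumℤ (map f l) + sumℤ (map g l)
  sumℤ-map-+ f g []      = refl
  sumℤ-map-+ f g (a ∷ l) = trans (cong (_+_ (f a + g a)) (sumℤ-map-+ f g l))
                                 (+-interchange (f a) (g a) _ _)

  sumℤ-map-* : ∀ c (f : A → ℤ) (l : List A) → sumℤ (map (λ a → c * f a) l) ≡ c * sumℤ (map f l)
  sumℤ-map-* c f []      = sym (ℤ.*-zeroʳ c)
  sumℤ-map-* c f (a ∷ l) = trans (cong (_+_ (c * f a)) (sumℤ-map-* c f l))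
                                 (sym (ℤ.*-distribˡ-+ c (f a) _))

  sumℤ-map-0 : (l : List A) → sumℤ (map (λ _ → + 0) l) ≡ + 0
  sumℤ-map-0 []      = refl
  sumℤ-map-0 (_ ∷ l) = trans (ℤ.+-identityˡ _) (sumℤ-map-0 l)

sumℤ-applyUpTo : ∀ m (f : ℕ → ℤ) (g : ℕ → ℕ) → sumℤ (map f (applyUpTo g m)) ≡ ∑< m (f ∘ g)
sumℤ-applyUpTo zero    f g = refl
sumℤ-applyUpTo (suc m) f g = cong (_+_ (f (g 0))) (sumℤ-applyUpTo m f (g ∘ suc))

sumℤ-allSubsets-suc : (g : Subset (suc n) → ℤ) →
  sumℤ (map g (allSubsets (suc n)))
    ≡ sumℤ (map (g ∘ (outside ∷_)) (allSubsets n)) + sumℤ (map (g ∘ (inside ∷_)) (allSubsets n))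
sumℤ-allSubsets-suc {n} g = begin
  sumℤ (map g (map (outside ∷_) L ++ map (inside ∷_) L))
    ≡⟨ cong sumℤ (map-++ g (map (outside ∷_) L) _) ⟩
  sumℤ (map g (map (outside ∷_) L) ++ map g (map (inside ∷_) L))
    ≡⟨ sumℤ-++ (map g (map (outside ∷_) L)) _ ⟩
  sumℤ (map g (map (outside ∷_) L)) + sumℤ (map g (map (inside ∷_) L))
    ≡⟨ cong₂ _+_ (cong sumℤ (map-∘ L)) (cong sumℤ (map-∘ L)) ⟨
  sumℤ (map (g ∘ (outside ∷_)) L) + sumℤ (map (g ∘ (inside ∷_)) L) ∎
  where
  open ≡-Reasoning
  L = allSubsets n

sumℤ-⊆-by-size : (H : Subset n) (φ : ℕ → ℤ) →
  sumℤ (map (weight⊆ H φ) (allSubsets n))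
    ≡ ∑< (suc ∣ H ∣) (λ j → + (∣ H ∣ C j) * φ j)
sumℤ-⊆-by-size [] φ = cong (_+ + 0) (sym (ℤ.*-identityˡ (φ 0)))
sumℤ-⊆-by-size {suc n} (outside ∷ H) φ =
  trans (sumℤ-allSubsets-suc {n} _)
        (trans (cong₂ _+_ (sumℤ-⊆-by-size H φ) (sumℤ-map-0 (allSubsets n))) (ℤ.+-identityʳ _))
sumℤ-⊆-by-size {suc n} (inside ∷ H) φ =
  trans (sumℤ-allSubsets-suc {n} _)
        (trans (cong₂ _+_ (sumℤ-⊆-by-size H φ) (sumℤ-⊆-by-size H (φ ∘ suc))) (∑<-pascal ∣ H ∣ φ))

sumℤ-⊆-powFrom : (H : Subset n) (k : ℕ) (z : ℤ) →
  sumℤ (map (weight⊆ H (powFrom k z)) (allSubsets n))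
    ≡ sumRange k ∣ H ∣ (λ j → + (∣ H ∣ C j) * z ^ (j ∸ k))
sumℤ-⊆-powFrom H k z = begin
  sumℤ (map (weight⊆ H (powFrom k z)) (allSubsets _))
    ≡⟨ sumℤ-⊆-by-size H (powFrom k z) ⟩
  ∑< (suc h) (λ j → + (h C j) * powFrom k z j)
    ≡⟨ ∑<-drop k (suc h) _ (λ j j<k → trans (cong (+ (h C j) *_) (powFrom-< z j<k)) (ℤ.*-zeroʳ (+ (h C j)))) ⟩
  ∑< (suc h ∸ k) (λ i → + (h C (k ℕ.+ i)) * powFrom k z (k ℕ.+ i))
    ≡⟨ ∑<-cong (suc h ∸ k) (λ i → cong (+ (h C (k ℕ.+ i)) *_) (powFrom-≥ z (ℕ.m≤m+n k i))) ⟩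
  ∑< (suc h ∸ k) (λ i → + (h C (k ℕ.+ i)) * z ^ (k ℕ.+ i ∸ k))
    ≡⟨ sumℤ-applyUpTo (suc h ∸ k) _ (λ i → i) ⟨
  sumRange k h (λ j → + (h C j) * z ^ (j ∸ k)) ∎
  where
  open ≡-Reasoning
  h = ∣ H ∣

¬StressedHyperplane-rank0 : {b : BasisPred n} → IsMatroid b → ∀ {H} → ¬ StressedHyperplane b 0 H
¬StressedHyperplane-rank0 {n} M (_ , circuit) with IsMatroid.nonempty M
... | B , t = proj₁ (circuit ⊥ ⊥⊆ (∣⊥∣≡0 n)) (B , t , ⊥⊆)

proposition3p13 : (n : ℕ) (basis? : BasisPred n) → IsMatroid basis? →
    (k : ℕ) → rk basis? ⊤ ≡ k →
    (H : Subset n) → StressedHyperplane basis? k H →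
    (h : ℕ) → ∣ H ∣ ≡ h →
    (x y : ℤ) →
    tutte (relax basis? k H) x y
      ≡ tutte basis? x y
        + (x + y - x * y) * sumRange k h (λ j → (+ (h C j)) * ((y - + 1) ^ (j ∸ k)))
proposition3p13 n b M zero    _   H stressed _ _    x y = ⊥-elim (¬StressedHyperplane-rank0 M stressed)
proposition3p13 n b M (suc r) rk⊤ H stressed _ refl x y = begin
  sumℤ (map (tutteTerm relaxed x y) L)
    ≡⟨ cong sumℤ (map-cong (tutteTerm-relaxed x y) L) ⟩
  sumℤ (map (λ A → tutteTerm b x y A + c * g A) L)
    ≡⟨ sumℤ-map-+ (tutteTerm b x y) (λ A → c * g A) L ⟩
  tutte b x y + sumℤ (map (λ A → c * g A) L)
    ≡⟨ cong (_+_ (tutte b x y)) (sumℤ-map-* c g L) ⟩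
  tutte b x y + c * sumℤ (map g L)
    ≡⟨ cong (λ s → tutte b x y + c * s) (sumℤ-⊆-powFrom H (suc r) (y - + 1)) ⟩
  tutte b x y + c * sumRange (suc r) ∣ H ∣ (λ j → + (∣ H ∣ C j) * (y - + 1) ^ (j ∸ suc r)) ∎
  where
  open ≡-Reasoning
  open Relaxation M rk⊤ stressed
  L = allSubsets n
  c = x + y - x * y
  g = weight⊆ H (powFrom (suc r) (y - + 1))
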